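{- Let $G=(V,E)$ be a directed graph, let $B\subseteq V$ and let $d>0$ be an integer. Let $P$ be a path that is $(B,d)$-covered and has $|P|\geq d$. Then $P$ can be written as $P=P_1\cdots P_k$ such that $|P_i|\in [d,3d]$ for each $i=1,\ldots,k$, and $P_i$ starts with a vertex of $B$ for each $i=2,\ldots,k$.
   Context: $|P|$ denotes the number of edges (hop-length) of a path $P$. A path $P$ is $(B,d)$-covered if $P=Q_1\cdots Q_r$ with $Q_i$ a $u_i\to v_i$ path, $|Q_i|\le d$ for all $i$, and $u_i\in B$ for all $i\ge2$. -}

module Defs where

open import Data.Nat using (ℕ; zero; suc; _+_; _*_; _≤_)
open import Data.List using (List; []; _∷_)
open import Data.List.Relation.Unary.Unique.Propositional using (Unique)
open import Data.Product using (_×_)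
open import Relation.Binary.PropositionalEquality using (_≡_)

module _ {V : Set} (E : V → V → Set) where

  data Walk : V → V → Set where
    [] : ∀ {u} → Walk u u
    _∷_ : ∀ {u w v} → E u w → Walk w v → Walk u v

  len : ∀ {u v} → Walk u v → ℕ
  len [] = 0
  len (_ ∷ p) = suc (len p)

  _++ʷ_ : ∀ {u w v} → Walk u w → Walk w v → Walk u v
  [] ++ʷ q = q
  (e ∷ p) ++ʷ q = e ∷ (p ++ʷ q)

  vertices : ∀ {u v} → Walk u v → List V
  vertices {u} [] = u ∷ []
  vertices {u} (_ ∷ p) = u ∷ vertices p

  IsPath : ∀ {u v} → Walk u v → Set
  IsPath p = Unique (vertices p)

  -- Split F L P : P = Q₁ ⋯ Q_r with F Q₁ and L Qᵢ for all i ≥ 2 (r ≥ 1).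
  data Split (F L : ∀ {u v} → Walk u v → Set) : ∀ {u v} → Walk u v → Set₁ where
    one  : ∀ {u v} {P : Walk u v} → F P → Split F L P
    more : ∀ {u w v} {P : Walk u v} (Q : Walk u w) (R : Walk w v) →
           P ≡ Q ++ʷ R → F Q → Split L L R → Split F L P

  Covered : (B : V → Set) (d : ℕ) → ∀ {u v} → Walk u v → Set₁
  Covered B d = Split (λ Q → len Q ≤ d) (λ {u} Q → B u × len Q ≤ d)

  GoodDecomp : (B : V → Set) (d : ℕ) → ∀ {u v} → Walk u v → Set₁
  GoodDecomp B d = Split (λ Q → d ≤ len Q × len Q ≤ 3 * d)
                         (λ {u} Q → B u × (d ≤ len Q × len Q ≤ 3 * d))

-- Cut P greedily. Glue the covering pieces Q₁, Q₂, … onto an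
-- accumulator A until |A| ≥ d; then A becomes the next part, unless fewer than
-- d edges remain, in which case A and the rest form the last part. Since each
-- Qᵢ has at most d edges and A had fewer than d before the last one was glued
-- on, |A| ≤ 2d throughout, so every part has between d and 3d edges; every cut
-- is made at the start of some Qᵢ with i ≥ 2, hence at a vertex of B.
module Submission where

open import Defs
open import Data.Nat using (ℕ; suc; _≤_; _<_; _>_; _+_; _*_; _≤?_)
open import Data.Nat.Properties
open import Data.Product using (_×_; _,_)
open import Relation.Binary.PropositionalEquality
open import Relation.Nullary using (yes; no)

module _ (d : ℕ) {a : ℕ} where

  ≤d⇒≤2*d : a ≤ d → a ≤ 2 * d
  ≤d⇒≤2*d a≤d = ≤-trans a≤d (m≤m+n d (1 * d))

  ≤2*d⇒≤3*d : a ≤ 2 * d → a ≤ 3 * d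
  ≤2*d⇒≤3*d a≤2d = ≤-trans a≤2d (m≤n+m (2 * d) d)

  <d∧≤d⇒+≤2*d : ∀ {b} → a < d → b ≤ d → a + b ≤ 2 * d
  <d∧≤d⇒+≤2*d a<d b≤d = +-mono-≤ (<⇒≤ a<d) (≤-trans b≤d (≤-reflexive (sym (*-identityˡ d))))

  ≤2*d∧≤d⇒+≤3*d : ∀ {b} → a ≤ 2 * d → b ≤ d → a + b ≤ 3 * d
  ≤2*d∧≤d⇒+≤3*d {b} a≤2d b≤d = subst (_≤ 3 * d) (+-comm b a) (+-mono-≤ b≤d a≤2d)

module _ {V : Set} {E : V → V → Set} where

  private
    ∣_∣ : ∀ {u v} → Walk E u v → ℕ
    ∣_∣ = len E

    infixr 5 _++_
    _++_ : ∀ {u w v} → Walk E u w → Walk E w v → Walk E u v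
    _++_ = _++ʷ_ E

  len-++ʷ : ∀ {u w v} (p : Walk E u w) (q : Walk E w v) → ∣ p ++ q ∣ ≡ ∣ p ∣ + ∣ q ∣
  len-++ʷ [] q = refl
  len-++ʷ (e ∷ p) q = cong suc (len-++ʷ p q)

  ++ʷ-assoc : ∀ {u w x v} (p : Walk E u w) (q : Walk E w x) (r : Walk E x v) →
              (p ++ q) ++ r ≡ p ++ (q ++ r)
  ++ʷ-assoc [] q r = refl
  ++ʷ-assoc (e ∷ p) q r = cong (e ∷_) (++ʷ-assoc p q r)

  StartsIn : (V → Set) → (∀ {u v} → Walk E u v → Set) → ∀ {u v} → Walk E u v → Set
  StartsIn B F {u} Q = B u × F Q

  Split-startsIn : ∀ {B : V → Set} {F L : ∀ {u v} → Walk E u v → Set} {u v} {P : Walk E u v} →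
                   B u → Split E F L P → Split E (StartsIn B F) L P
  Split-startsIn b (one f) = one (b , f)
  Split-startsIn b (more Q R eq f rest) = more Q R eq (b , f) rest

  module _ (d : ℕ) where

    Short : ∀ {u v} → Walk E u v → Set
    Short Q = ∣ Q ∣ ≤ d

    Sized : ∀ {u v} → Walk E u v → Set
    Sized Q = d ≤ ∣ Q ∣ × ∣ Q ∣ ≤ 3 * d

    sized-++ʷ : ∀ {u w v} (A : Walk E u w) (R : Walk E w v) →
                d ≤ ∣ A ∣ + ∣ R ∣ → ∣ A ∣ + ∣ R ∣ ≤ 3 * d → Sized (A ++ R)
    sized-++ʷ A R lower upper rewrite len-++ʷ A R = lower , upper

  module _ (B : V → Set) (d : ℕ) where

    goodDecomp-++ʷ : ∀ {u w v} (A : Walk E u w) (R : Walk E w v) → ∣ A ∣ ≤ 2 * d →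
                     Split E (StartsIn B (Short d)) (StartsIn B (Short d)) R →
                     d ≤ ∣ A ∣ + ∣ R ∣ → GoodDecomp E B d (A ++ R)
    goodDecomp-++ʷ A R A≤2d (one (_ , R≤d)) d≤AR =
      one (sized-++ʷ d A R d≤AR (≤2*d∧≤d⇒+≤3*d d A≤2d R≤d))
    goodDecomp-++ʷ A _ A≤2d (more Q R refl (b , Q≤d) rest) d≤AQR
      with d ≤? ∣ A ∣ | d ≤? ∣ Q ++ R ∣
    ... | yes d≤A | yes d≤QR =
      more A (Q ++ R) refl (d≤A , ≤2*d⇒≤3*d d A≤2d)
        (Split-startsIn b (goodDecomp-++ʷ Q R (≤d⇒≤2*d d Q≤d) rest
          (subst (d ≤_) (len-++ʷ Q R) d≤QR)))
    ... | yes _ | no d≰QR =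
      one (sized-++ʷ d A (Q ++ R) d≤AQR (≤2*d∧≤d⇒+≤3*d d A≤2d (<⇒≤ (≰⇒> d≰QR))))
    ... | no d≰A | _ =
      subst (GoodDecomp E B d) (++ʷ-assoc A Q R)
        (goodDecomp-++ʷ (A ++ Q) R AQ≤2d rest d≤AQ+R)
      where
      AQ≤2d : ∣ A ++ Q ∣ ≤ 2 * d
      AQ≤2d rewrite len-++ʷ A Q = <d∧≤d⇒+≤2*d d (≰⇒> d≰A) Q≤d

      d≤AQ+R : d ≤ ∣ A ++ Q ∣ + ∣ R ∣
      d≤AQ+R = subst (d ≤_) (begin
        (∣ A ∣ + ∣ Q ++ R ∣)       ≡⟨ cong (∣ A ∣ +_) (len-++ʷ Q R) ⟩
        (∣ A ∣ + (∣ Q ∣ + ∣ R ∣)) ≡⟨ +-assoc (∣ A ∣) (∣ Q ∣) (∣ R ∣) ⟨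
        ((∣ A ∣ + ∣ Q ∣) + ∣ R ∣) ≡⟨ cong (_+ ∣ R ∣) (len-++ʷ A Q) ⟨
        (∣ A ++ Q ∣ + ∣ R ∣)       ∎) d≤AQR
        where open ≡-Reasoning

mainTheorem14 : {V : Set} (E : V → V → Set) (B : V → Set) (d : ℕ) → d > 0 →
    ∀ {u v} (P : Walk E u v) → IsPath E P → Covered E B d P → d ≤ len E P →
    GoodDecomp E B d P
mainTheorem14 E B d _ P _ (one P≤d) d≤P = one (d≤P , ≤2*d⇒≤3*d d (≤d⇒≤2*d d P≤d))
mainTheorem14 E B d _ _ _ (more Q R refl Q≤d rest) d≤QR =
  goodDecomp-++ʷ B d Q R (≤d⇒≤2*d d Q≤d) rest (subst (d ≤_) (len-++ʷ Q R) d≤QR)
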